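{- Let $M\in\Sigma^{n\times n}$ with $n=k^\alpha$ for integers $k\ge 2$, $\alpha\ge1$. In the two-dimensional block tree (2D-BT) of $M$ with parameter $k$, the number of marked nodes at any level is $O(\delta_{2D}(M)+\sqrt{n\,\delta_{2D}(M)})$ (with an absolute constant, independent of the level and of $k$).
   Context: For $k'\in[1,n]$ let $d_{k'\times k'}(M)$ be the number of distinct $k'\times k'$ submatrices (contiguous square blocks) of $M$, and $\delta_{2D}(M)=\max\{d_{k'\times k'}(M)/k'^2 : k'\in[1,n]\}$. An occurrence of a square matrix $X$ in $M$ is a submatrix of $M$ equal to $X$; the first occurrence is the one whose top-left corner comes first in row-major order. The 2D-BT of $M$ with parameter $k$: the root (level 0, considered marked) represents $M$. At level $\ell\ge1$, a block is a submatrix of size $(n/k^\ell)\times(n/k^\ell)$ whose top-left corner is $(1+\lambda n/k^\ell,1+\mu n/k^\ell)$ for integers $\lambda,\mu\ge0$; the nodes at level $\ell$ are the $k^2$ blocks partitioning the block of each marked node at level $\ell-1$. A node at level $\ell$ is marked iff its block shares at least one cell with the first occurrence of some $(n/k^\ell)\times(n/k^\ell)$ submatrix of $M$; marked nodes are recursively split (until some final level where blocks are stored explicitly). An unmarked node is a leaf storing pointers to the marked nodes of the same level overlapping the first occurrence of its block, together with the offset of that occurrence. -}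

module Defs where

open import Data.Nat using (ℕ; zero; suc; _+_; _*_; _∸_; _^_; _≤_; _<_)
open import Data.Fin using (Fin; toℕ)
open import Data.Vec using (Vec; tabulate)
open import Data.Vec.Properties using (≡-dec)
open import Data.List using (List; []; _∷_; length; map; concatMap; upTo; deduplicate; foldr)
open import Data.Product using (_×_; _,_; Σ-syntax; ∃-syntax)
open import Data.Sum using (_⊎_)
open import Data.Integer using (+_)
open import Data.Rational using (ℚ; _/_; _⊔_; 0ℚ)
open import Relation.Binary.PropositionalEquality using (_≡_; _≢_)
open import Relation.Binary.Definitions using (DecidableEquality)

-- A matrix M ∈ Σ^{n×n} is represented by a function M : ℕ → ℕ → Σ;
-- only the entries M i j with i , j < n are ever inspected (0-indexed).
Matrix : Set → Set
Matrix Σ = ℕ → ℕ → Σ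

sub : {Σ : Set} → Matrix Σ → (s i j : ℕ) → Vec (Vec Σ s) s
sub M s i j = tabulate (λ a → tabulate (λ b → M (i + toℕ a) (j + toℕ b)))

positions : (n s : ℕ) → List (ℕ × ℕ)
positions n s = concatMap (λ i → map (λ j → (i , j)) (upTo (suc (n ∸ s)))) (upTo (suc (n ∸ s)))

dsq : {Σ : Set} → DecidableEquality Σ → (n : ℕ) → Matrix Σ → (s : ℕ) → ℕ
dsq _≟_ n M s = length (deduplicate (≡-dec (≡-dec _≟_)) (map (λ p → sub M s (Data.Product.proj₁ p) (Data.Product.proj₂ p)) (positions n s)))

-- δ_2D(M) = max { d_{s×s}(M) / s² : s ∈ [1 , n] }  (a rational number; 0 if n = 0).
δ2D : {Σ : Set} → DecidableEquality Σ → (n : ℕ) → Matrix Σ → ℚ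
δ2D _≟_ n M = foldr (λ t acc → ((+ dsq _≟_ n M (suc t)) / (suc t * suc t)) ⊔ acc) 0ℚ (upTo n)

Valid : (n s i j : ℕ) → Set
Valid n s i j = i + s ≤ n × j + s ≤ n

_<rm_ : ℕ × ℕ → ℕ × ℕ → Set
(i' , j') <rm (i , j) = i' < i ⊎ (i' ≡ i × j' < j)

FirstOcc : {Σ : Set} → (n : ℕ) → Matrix Σ → (s i j : ℕ) → Set
FirstOcc n M s i j =
  Valid n s i j ×
  (∀ i' j' → Valid n s i' j' → (i' , j') <rm (i , j) → sub M s i' j' ≢ sub M s i j)

InSquare : (s i j x y : ℕ) → Set
InSquare s i j x y = i ≤ x × x < i + s × j ≤ y × y < j + s

-- A node at level ℓ is identified by (λ , μ); its block has size b = k^(α ∸ ℓ) = n / k^ℓ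
-- and top-left corner (λ b , μ b) (0-indexed).
Marked : {Σ : Set} → (k α : ℕ) → Matrix Σ → (ℓ λ' μ : ℕ) → Set
Marked k α M zero λ' μ = λ' ≡ 0 × μ ≡ 0
Marked k α M (suc ℓ) λ' μ =
  (Σ[ p ∈ ℕ ] Σ[ q ∈ ℕ ]
     Marked k α M ℓ p q × p * k ≤ λ' × λ' < p * k + k × q * k ≤ μ × μ < q * k + k)
  × (∃[ i ] ∃[ j ] FirstOcc (k ^ α) M b i j ×
       (∃[ x ] ∃[ y ] InSquare b (λ' * b) (μ * b) x y × InSquare b i j x y))
  where b = k ^ (α ∸ suc ℓ)

module Submission where

-- At a level with K × K blocks of side B (so n = K B), every marked block meets a first
-- occurrence of a B × B submatrix, and every 4B × 4B window containing a first occurrence is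
-- itself one; so windows count against d = d_{4B×4B}(M) ≤ 16 B² δ.  Along each coordinate
-- a window can be chosen in B positions next to an interior block and in one position next
-- to each of the four border blocks, all these positions being distinct.  Hence at most
-- d / B² ≤ 16 δ marked blocks are interior in both coordinates, at most 16 are border blocks
-- in both, and the c blocks interior in exactly one coordinate satisfy c ≤ d / B ≤ 16 B δ and
-- c ≤ 4K, so c² ≤ 64 n δ ≤ (8 s)².  Levels with K < 7 have at most 36 blocks altogether.

module ListCounting where
  open import Data.Nat using (suc; _+_; _*_; _≤_; s≤s; z≤n)
  open import Data.Nat.Properties using (+-suc)
  open import Data.List using (List; []; _∷_; length; map; filter; cartesianProduct)
  open import Data.List.Properties using (length-map; length-++; length-removeAt′)
  open import Data.List.Membership.Propositional using (_∈_)
  open import Data.List.Relation.Unary.Any using (here; there; index; _─_)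
  import Data.List.Relation.Unary.All as All
  import Data.List.Relation.Unary.All.Properties as All
  open import Data.List.Relation.Unary.AllPairs using ([]; _∷_)
  open import Data.List.Relation.Unary.Unique.Propositional using (Unique)
  open import Data.Product using (_,_)
  open import Data.Empty using (⊥-elim)
  open import Data.Bool using (Bool; true; false; _≟_)
  open import Relation.Binary.PropositionalEquality using (_≡_; _≢_; refl; sym; trans; cong; cong₂; subst)

  module _ {A : Set} where

    ∈-─ : ∀ {x z} {ys : List A} (p : x ∈ ys) → z ∈ ys → z ≢ x → z ∈ (ys ─ p)
    ∈-─ (here refl) (here refl) z≢x = ⊥-elim (z≢x refl)
    ∈-─ (there p)   (here z≡y)  _   = here z≡y
    ∈-─ (here _)    (there q)   _   = q
    ∈-─ (there p)   (there q)   z≢x = there (∈-─ p q z≢x)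

    Unique-⊆⇒length-≤ : ∀ {xs ys : List A} → Unique xs → (∀ {z} → z ∈ xs → z ∈ ys) → length xs ≤ length ys
    Unique-⊆⇒length-≤ {[]}     _          _   = z≤n
    Unique-⊆⇒length-≤ {x ∷ xs} {ys} (x∉xs ∷ u) xs⊆ys =
      subst (suc (length xs) ≤_) (sym (length-removeAt′ ys (index x∈ys)))
        (s≤s (Unique-⊆⇒length-≤ u λ z∈xs → ∈-─ x∈ys (xs⊆ys (there z∈xs)) λ z≡x → All.lookup x∉xs z∈xs (sym z≡x)))
      where x∈ys = xs⊆ys (here refl)

  module _ {A B : Set} where

    Unique-map⁺ : (f : A → B) {xs : List A} → Unique xs →
      (∀ {x y} → x ∈ xs → y ∈ xs → f x ≡ f y → x ≡ y) → Unique (map f xs)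
    Unique-map⁺ f {[]}     _          _   = []
    Unique-map⁺ f {x ∷ xs} (x∉xs ∷ u) inj =
      All.map⁺ (All.tabulate λ y∈xs fx≡fy → All.lookup x∉xs y∈xs (inj (here refl) (there y∈xs) fx≡fy))
      ∷ Unique-map⁺ f u λ p q → inj (there p) (there q)

    length-cartesianProduct : (xs : List A) (ys : List B) → length (cartesianProduct xs ys) ≡ length xs * length ys
    length-cartesianProduct []       ys = refl
    length-cartesianProduct (x ∷ xs) ys =
      trans (length-++ (map (x ,_) ys)) (cong₂ _+_ (length-map (x ,_) ys) (length-cartesianProduct xs ys))

  module _ {A : Set} (f : A → Bool) where

    length-filter-true+false : (xs : List A) →
      length (filter (λ x → f x ≟ true) xs) + length (filter (λ x → f x ≟ false) xs) ≡ length xs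
    length-filter-true+false [] = refl
    length-filter-true+false (x ∷ xs) with f x
    ... | true  = cong suc (length-filter-true+false xs)
    ... | false = trans (+-suc _ _) (cong suc (length-filter-true+false xs))

module Rationals where
  open import Data.Nat as ℕ using (ℕ; suc; NonZero)
  import Data.Nat.Properties as ℕ
  open import Data.Integer as ℤ using (+_)
  import Data.Integer.Properties as ℤ
  open import Data.Rational using (ℚ; _/_; _⊔_; 0ℚ; 1ℚ; _*_; _+_; _≤_; _<_; NonNegative; Positive; toℚᵘ; positive; nonNegative)
  open import Data.Rational.Properties
  open import Data.Rational.Unnormalised as ℚᵘ using (mkℚᵘ; *≡*; *≤*)
  import Data.Rational.Unnormalised.Properties as ℚᵘ
  open import Data.Nat.Tactic.RingSolver using (solve)
  open import Algebra.Bundles using (CommutativeRing)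
  open import Algebra.Properties.CommutativeSemigroup (CommutativeRing.*-commutativeSemigroup +-*-commutativeRing) using (interchange)
  open import Data.List using (List; []; _∷_; foldr)
  open import Data.List.Membership.Propositional using (_∈_)
  open import Data.List.Relation.Unary.Any using (here; there)
  open import Relation.Nullary using (yes; no; contradiction)
  open import Relation.Binary.PropositionalEquality using (_≡_; refl; sym; trans; cong; cong₂)

  fromℕ : ℕ → ℚ
  fromℕ a = + a / 1

  private
    toℚᵘ-fromℕ : ∀ a → toℚᵘ (fromℕ a) ℚᵘ.≃ mkℚᵘ (+ a) 0
    toℚᵘ-fromℕ a = toℚᵘ-fromℚᵘ (mkℚᵘ (+ a) 0)

  fromℕ-homo-* : ∀ a b → fromℕ (a ℕ.* b) ≡ fromℕ a * fromℕ b
  fromℕ-homo-* a b = toℚᵘ-injective (begin-equality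
    toℚᵘ (fromℕ (a ℕ.* b))               ≃⟨ toℚᵘ-fromℕ (a ℕ.* b) ⟩
    mkℚᵘ (+ (a ℕ.* b)) 0                 ≃⟨ *≡* (cong (ℤ._* + 1) (ℤ.pos-* a b)) ⟩
    mkℚᵘ (+ a) 0 ℚᵘ.* mkℚᵘ (+ b) 0       ≃⟨ ℚᵘ.*-cong (ℚᵘ.≃-sym (toℚᵘ-fromℕ a)) (ℚᵘ.≃-sym (toℚᵘ-fromℕ b)) ⟩
    toℚᵘ (fromℕ a) ℚᵘ.* toℚᵘ (fromℕ b)   ≃⟨ ℚᵘ.≃-sym (toℚᵘ-homo-* (fromℕ a) (fromℕ b)) ⟩
    toℚᵘ (fromℕ a * fromℕ b)             ∎)
    where open ℚᵘ.≤-Reasoning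

  fromℕ-homo-+ : ∀ a b → fromℕ (a ℕ.+ b) ≡ fromℕ a + fromℕ b
  fromℕ-homo-+ a b = toℚᵘ-injective (begin-equality
    toℚᵘ (fromℕ (a ℕ.+ b))               ≃⟨ toℚᵘ-fromℕ (a ℕ.+ b) ⟩
    mkℚᵘ (+ (a ℕ.+ b)) 0                 ≃⟨ *≡* (cong (ℤ._* + 1) (trans (ℤ.pos-+ a b)
                                                (sym (cong₂ ℤ._+_ (ℤ.*-identityʳ (+ a)) (ℤ.*-identityʳ (+ b)))))) ⟩
    mkℚᵘ (+ a) 0 ℚᵘ.+ mkℚᵘ (+ b) 0       ≃⟨ ℚᵘ.+-cong (ℚᵘ.≃-sym (toℚᵘ-fromℕ a)) (ℚᵘ.≃-sym (toℚᵘ-fromℕ b)) ⟩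
    toℚᵘ (fromℕ a) ℚᵘ.+ toℚᵘ (fromℕ b)   ≃⟨ ℚᵘ.≃-sym (toℚᵘ-homo-+ (fromℕ a) (fromℕ b)) ⟩
    toℚᵘ (fromℕ a + fromℕ b)             ∎)
    where open ℚᵘ.≤-Reasoning

  fromℕ-mono-≤ : ∀ {a b} → a ℕ.≤ b → fromℕ a ≤ fromℕ b
  fromℕ-mono-≤ {a} {b} a≤b = toℚᵘ-cancel-≤ (begin
    toℚᵘ (fromℕ a)   ≃⟨ toℚᵘ-fromℕ a ⟩
    mkℚᵘ (+ a) 0     ≤⟨ *≤* (ℤ.*-monoʳ-≤-nonNeg (+ 1) (ℤ.+≤+ a≤b)) ⟩
    mkℚᵘ (+ b) 0     ≃⟨ ℚᵘ.≃-sym (toℚᵘ-fromℕ b) ⟩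
    toℚᵘ (fromℕ b)   ∎)
    where open ℚᵘ.≤-Reasoning

  fromℕ-*-/ : ∀ q d → fromℕ (suc q) * (+ d / suc q) ≡ fromℕ d
  fromℕ-*-/ q d = toℚᵘ-injective (begin-equality
    toℚᵘ (fromℕ (suc q) * (+ d / suc q))          ≃⟨ toℚᵘ-homo-* (fromℕ (suc q)) (+ d / suc q) ⟩
    toℚᵘ (fromℕ (suc q)) ℚᵘ.* toℚᵘ (+ d / suc q)  ≃⟨ ℚᵘ.*-cong (toℚᵘ-fromℕ (suc q)) (toℚᵘ-fromℚᵘ (mkℚᵘ (+ d) q)) ⟩
    mkℚᵘ (+ suc q) 0 ℚᵘ.* mkℚᵘ (+ d) q            ≃⟨ *≡* (trans (ℤ.*-identityʳ _) (trans (ℤ.*-comm (+ suc q) (+ d))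
                                                       (cong (λ z → + d ℤ.* + suc z) (sym (ℕ.+-identityʳ q))))) ⟩
    mkℚᵘ (+ d) 0                                  ≃⟨ ℚᵘ.≃-sym (toℚᵘ-fromℕ d) ⟩
    toℚᵘ (fromℕ d)                                ∎)
    where open ℚᵘ.≤-Reasoning

  fromℕ-nonNeg : ∀ a → NonNegative (fromℕ a)
  fromℕ-nonNeg a = normalize-nonNeg a 1

  fromℕ-pos : ∀ a .{{_ : NonZero a}} → Positive (fromℕ a)
  fromℕ-pos (suc a) = normalize-pos (suc a) 1

  foldr-⊔-upper : (f : ℕ → ℚ) {t : ℕ} (xs : List ℕ) → t ∈ xs → f t ≤ foldr (λ t acc → f t ⊔ acc) 0ℚ xs
  foldr-⊔-upper f (x ∷ xs) (here refl) = p≤p⊔q (f x) _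
  foldr-⊔-upper f (x ∷ xs) (there t∈xs) = ≤-trans (foldr-⊔-upper f xs t∈xs) (p≤q⊔p (f x) _)

  *-self-≤⇒≤ : ∀ {p q} → 0ℚ ≤ q → p * p ≤ q * q → p ≤ q
  *-self-≤⇒≤ {p} {q} 0≤q pp≤qq with p ≤? q
  ... | yes p≤q = p≤q
  ... | no  p≰q = contradiction (<-≤-trans qq<pp pp≤qq) (<-irrefl refl)
    where
    q<p = ≰⇒> p≰q
    instance
      _ : NonNegative q
      _ = nonNegative 0≤q
      _ : Positive p
      _ = positive (≤-<-trans 0≤q q<p)
    qq<pp : q * q < p * p
    qq<pp = ≤-<-trans (*-monoʳ-≤-nonNeg q (<⇒≤ q<p)) (*-monoʳ-<-pos p q<p)

  fromℕ-*-assoc : ∀ a b x → fromℕ a * (fromℕ b * x) ≡ fromℕ (a ℕ.* b) * x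
  fromℕ-*-assoc a b x = trans (sym (*-assoc (fromℕ a) (fromℕ b) x)) (cong (_* x) (sym (fromℕ-homo-* a b)))

  p≤p+q : ∀ {p q} → 0ℚ ≤ q → p ≤ p + q
  p≤p+q {p} 0≤q = ≤-trans (≤-reflexive (sym (+-identityʳ p))) (+-monoʳ-≤ p 0≤q)

  fromℕ-≤-scaled : ∀ {x} {c} k → fromℕ 1 ≤ x → c ℕ.≤ k → fromℕ c ≤ fromℕ k * x
  fromℕ-≤-scaled {x} {c} k 1≤x c≤k = begin
    fromℕ c        ≤⟨ fromℕ-mono-≤ c≤k ⟩
    fromℕ k        ≡⟨ sym (*-identityʳ (fromℕ k)) ⟩
    fromℕ k * 1ℚ   ≤⟨ *-monoˡ-≤-nonNeg (fromℕ k) {{fromℕ-nonNeg k}} 1≤x ⟩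
    fromℕ k * x    ∎
    where open ≤-Reasoning

  fromℕ-+-≤ : ∀ {x} a b k → fromℕ a ≤ fromℕ k * x → fromℕ b ≤ fromℕ k * x → fromℕ (a ℕ.+ b) ≤ fromℕ (k ℕ.+ k) * x
  fromℕ-+-≤ {x} a b k a≤ b≤ = begin
    fromℕ (a ℕ.+ b)              ≡⟨ fromℕ-homo-+ a b ⟩
    fromℕ a + fromℕ b            ≤⟨ +-mono-≤ a≤ b≤ ⟩
    fromℕ k * x + fromℕ k * x    ≡⟨ sym (*-distribʳ-+ x (fromℕ k) (fromℕ k)) ⟩
    (fromℕ k + fromℕ k) * x      ≡⟨ cong (_* x) (sym (fromℕ-homo-+ k k)) ⟩
    fromℕ (k ℕ.+ k) * x          ∎
    where open ≤-Reasoning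

  module ClassBounds {δ s : ℚ} (B K d : ℕ) .{{_ : NonZero B}}
    (1≤δ : fromℕ 1 ≤ δ) (0≤s : 0ℚ ≤ s)
    (d≤ : fromℕ d ≤ fromℕ ((4 ℕ.* B) ℕ.* (4 ℕ.* B)) * δ)
    (nδ≤ss : fromℕ (K ℕ.* B) * δ ≤ s * s) where

    open ≤-Reasoning

    instance
      δ-nonNeg : NonNegative δ
      δ-nonNeg = nonNegative (≤-trans (fromℕ-mono-≤ {0} {1} ℕ.z≤n) 1≤δ)
      s-nonNeg : NonNegative s
      s-nonNeg = nonNegative 0≤s

    middle-bound : ∀ c → c ℕ.* (B ℕ.* B) ℕ.≤ d → fromℕ c ≤ fromℕ 16 * δ
    middle-bound c cBB≤d = *-cancelˡ-≤-pos (fromℕ (B ℕ.* B)) {{fromℕ-pos (B ℕ.* B) {{ℕ.m*n≢0 B B}}}} (begin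
      fromℕ (B ℕ.* B) * fromℕ c             ≡⟨ sym (fromℕ-homo-* (B ℕ.* B) c) ⟩
      fromℕ (B ℕ.* B ℕ.* c)                 ≡⟨ cong fromℕ (ℕ.*-comm (B ℕ.* B) c) ⟩
      fromℕ (c ℕ.* (B ℕ.* B))               ≤⟨ fromℕ-mono-≤ cBB≤d ⟩
      fromℕ d                               ≤⟨ d≤ ⟩
      fromℕ ((4 ℕ.* B) ℕ.* (4 ℕ.* B)) * δ   ≡⟨ cong (λ z → fromℕ z * δ) 4B*4B≡B*B*16 ⟩
      fromℕ (B ℕ.* B ℕ.* 16) * δ            ≡⟨ sym (fromℕ-*-assoc (B ℕ.* B) 16 δ) ⟩
      fromℕ (B ℕ.* B) * (fromℕ 16 * δ)      ∎)
      where
      4B*4B≡B*B*16 : (4 ℕ.* B) ℕ.* (4 ℕ.* B) ≡ B ℕ.* B ℕ.* 16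
      4B*4B≡B*B*16 = solve (B ∷ [])

    edge-bound : ∀ c → c ℕ.* B ℕ.≤ d → c ℕ.≤ 4 ℕ.* K → fromℕ c ≤ fromℕ 8 * s
    edge-bound c cB≤d c≤4K = *-self-≤⇒≤ 0≤8s squares
      where
      0≤8s : 0ℚ ≤ fromℕ 8 * s
      0≤8s = nonNegative⁻¹ (fromℕ 8 * s) {{nonNeg*nonNeg⇒nonNeg (fromℕ 8) {{fromℕ-nonNeg 8}} s}}
      Bcc≤4Kd : B ℕ.* (c ℕ.* c) ℕ.≤ 4 ℕ.* K ℕ.* d
      Bcc≤4Kd = ℕ.≤-trans (ℕ.≤-reflexive Bcc≡ccB) (ℕ.*-mono-≤ c≤4K cB≤d)
        where
        Bcc≡ccB : B ℕ.* (c ℕ.* c) ≡ c ℕ.* (c ℕ.* B)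
        Bcc≡ccB = solve (B ∷ c ∷ [])
      4K*4B*4B≡B*64*KB : 4 ℕ.* K ℕ.* ((4 ℕ.* B) ℕ.* (4 ℕ.* B)) ≡ B ℕ.* 64 ℕ.* (K ℕ.* B)
      4K*4B*4B≡B*64*KB = solve (K ∷ B ∷ [])
      squares : fromℕ c * fromℕ c ≤ (fromℕ 8 * s) * (fromℕ 8 * s)
      squares = *-cancelˡ-≤-pos (fromℕ B) {{fromℕ-pos B}} (begin
        fromℕ B * (fromℕ c * fromℕ c)                        ≡⟨ cong (fromℕ B *_) (sym (fromℕ-homo-* c c)) ⟩
        fromℕ B * fromℕ (c ℕ.* c)                            ≡⟨ sym (fromℕ-homo-* B (c ℕ.* c)) ⟩
        fromℕ (B ℕ.* (c ℕ.* c))                              ≤⟨ fromℕ-mono-≤ Bcc≤4Kd ⟩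
        fromℕ (4 ℕ.* K ℕ.* d)                                ≡⟨ fromℕ-homo-* (4 ℕ.* K) d ⟩
        fromℕ (4 ℕ.* K) * fromℕ d                            ≤⟨ *-monoˡ-≤-nonNeg (fromℕ (4 ℕ.* K)) {{fromℕ-nonNeg (4 ℕ.* K)}} d≤ ⟩
        fromℕ (4 ℕ.* K) * (fromℕ ((4 ℕ.* B) ℕ.* (4 ℕ.* B)) * δ) ≡⟨ fromℕ-*-assoc (4 ℕ.* K) _ δ ⟩
        fromℕ (4 ℕ.* K ℕ.* ((4 ℕ.* B) ℕ.* (4 ℕ.* B))) * δ    ≡⟨ cong (λ z → fromℕ z * δ) 4K*4B*4B≡B*64*KB ⟩
        fromℕ (B ℕ.* 64 ℕ.* (K ℕ.* B)) * δ                   ≡⟨ sym (fromℕ-*-assoc (B ℕ.* 64) (K ℕ.* B) δ) ⟩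
        fromℕ (B ℕ.* 64) * (fromℕ (K ℕ.* B) * δ)             ≤⟨ *-monoˡ-≤-nonNeg (fromℕ (B ℕ.* 64)) {{fromℕ-nonNeg (B ℕ.* 64)}} nδ≤ss ⟩
        fromℕ (B ℕ.* 64) * (s * s)                           ≡⟨ sym (fromℕ-*-assoc B 64 (s * s)) ⟩
        fromℕ B * (fromℕ (8 ℕ.* 8) * (s * s))                ≡⟨ cong (λ z → fromℕ B * (z * (s * s))) (fromℕ-homo-* 8 8) ⟩
        fromℕ B * ((fromℕ 8 * fromℕ 8) * (s * s))            ≡⟨ cong (fromℕ B *_) (interchange (fromℕ 8) (fromℕ 8) s s) ⟩
        fromℕ B * ((fromℕ 8 * s) * (fromℕ 8 * s))            ∎)

    private
      δ≤δ+s : δ ≤ δ + s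
      δ≤δ+s = p≤p+q 0≤s
      s≤δ+s : s ≤ δ + s
      s≤δ+s = ≤-trans (≤-reflexive (sym (+-identityˡ s))) (+-monoˡ-≤ s (nonNegative⁻¹ δ))
      16δ≤16[δ+s] : fromℕ 16 * δ ≤ fromℕ 16 * (δ + s)
      16δ≤16[δ+s] = *-monoˡ-≤-nonNeg (fromℕ 16) {{fromℕ-nonNeg 16}} δ≤δ+s
      8s≤16[δ+s] : fromℕ 8 * s ≤ fromℕ 16 * (δ + s)
      8s≤16[δ+s] = ≤-trans (*-monoʳ-≤-nonNeg s (fromℕ-mono-≤ {8} {16} (ℕ.m≤m+n 8 8)))
                           (*-monoˡ-≤-nonNeg (fromℕ 16) {{fromℕ-nonNeg 16}} s≤δ+s)

    classes-bound : ∀ a b c e → a ℕ.* (B ℕ.* B) ℕ.≤ d → b ℕ.* B ℕ.≤ d → b ℕ.≤ 4 ℕ.* K →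
      c ℕ.* B ℕ.≤ d → c ℕ.≤ 4 ℕ.* K → e ℕ.≤ 16 → fromℕ ((a ℕ.+ b) ℕ.+ (c ℕ.+ e)) ≤ fromℕ 64 * (δ + s)
    classes-bound a b c e aBB≤d bB≤d b≤4K cB≤d c≤4K e≤16 =
      fromℕ-+-≤ {δ + s} (a ℕ.+ b) (c ℕ.+ e) 32
        (fromℕ-+-≤ {δ + s} a b 16 (≤-trans (middle-bound a aBB≤d) 16δ≤16[δ+s]) (≤-trans (edge-bound b bB≤d b≤4K) 8s≤16[δ+s]))
        (fromℕ-+-≤ {δ + s} c e 16 (≤-trans (edge-bound c cB≤d c≤4K) 8s≤16[δ+s]) (fromℕ-≤-scaled 16 1≤δ+s e≤16))
      where
      1≤δ+s : fromℕ 1 ≤ δ + s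
      1≤δ+s = ≤-trans 1≤δ δ≤δ+s

module FirstOccurrences where
  open import Defs
  open ListCounting
  open Rationals
  open import Data.Nat renaming (_≟_ to _≟ℕ_)
  open import Data.Nat.Properties
  open import Data.Fin using (Fin; toℕ; fromℕ<)
  open import Data.Fin.Properties using (toℕ<n; toℕ-fromℕ<)
  open import Data.Vec using (lookup)
  open import Data.Vec.Properties using (lookup∘tabulate; tabulate-cong; ≡-dec)
  open import Data.List using (List; [_]; length; map; upTo; deduplicate)
  open import Data.List.Properties using (length-map)
  open import Data.List.Membership.Propositional using (_∈_)
  open import Data.List.Membership.Propositional.Properties using (∈-upTo⁺; ∈-concatMap⁺; ∈-map⁺; ∈-map⁻; ∈-deduplicate⁺)
  open import Data.List.Relation.Unary.Any as Any using ()
  open import Data.List.Relation.Unary.Unique.Propositional using (Unique)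
  open import Data.Product using (_×_; _,_; proj₁; proj₂)
  open import Data.Product.Relation.Binary.Lex.Strict using (×-compare)
  open import Data.Product.Relation.Binary.Pointwise.NonDependent using (≡×≡⇒≡)
  open import Data.Sum using (_⊎_; inj₁; inj₂)
  open import Relation.Nullary using (yes; no; contradiction)
  open import Data.Product.Properties using () renaming (≡-dec to ×-≡-dec)
  open import Relation.Binary.Definitions using (DecidableEquality; tri<; tri≈; tri>)
  open import Relation.Binary.PropositionalEquality using (_≡_; _≢_; refl; sym; trans; cong; cong₂; subst; subst₂)
  open import Data.Integer using (+_)
  import Data.Rational as ℚ
  import Data.Rational.Properties as ℚ
  open import Data.List.Relation.Unary.Any using (here)
  import Data.List.Relation.Unary.All as All
  import Data.List.Relation.Unary.AllPairs as AllPairs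

  valid⇒∈positions : ∀ {n s i j} → Valid n s i j → (i , j) ∈ positions n s
  valid⇒∈positions {n} {s} {i} {j} (i+s≤n , j+s≤n) =
    ∈-concatMap⁺ (λ i → map (i ,_) (upTo (suc (n ∸ s))))
      (Any.map (λ { refl → ∈-map⁺ (i ,_) (∈-upTo⁺ (s≤s (m+n≤o⇒m≤o∸n j j+s≤n))) })
        (∈-upTo⁺ (s≤s (m+n≤o⇒m≤o∸n i i+s≤n))))

  <rm-connex : ∀ {p q} → p ≢ q → p <rm q ⊎ q <rm p
  <rm-connex {p} {q} p≢q with ×-compare sym <-cmp <-cmp p q
  ... | tri< p<q _ _ = inj₁ p<q
  ... | tri≈ _ p≈q _ = contradiction (≡×≡⇒≡ p≈q) p≢q
  ... | tri> _ _ q<p = inj₂ q<p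

  module _ {Σ : Set} (n : ℕ) (M : Matrix Σ) where

    FirstOcc-distinct : ∀ {s i j i' j'} → FirstOcc n M s i j → FirstOcc n M s i' j' → (i , j) ≢ (i' , j') →
      sub M s i j ≢ sub M s i' j'
    FirstOcc-distinct (v , earliest) (v' , earliest') ij≢i'j' with <rm-connex ij≢i'j'
    ... | inj₁ ij<i'j' = earliest' _ _ v ij<i'j'
    ... | inj₂ i'j'<ij = λ eq → earliest _ _ v' i'j'<ij (sym eq)

    length≤dsq : (_≟_ : DecidableEquality Σ) (s : ℕ) (Q : List (ℕ × ℕ)) → Unique Q →
      (∀ {p} → p ∈ Q → FirstOcc n M s (proj₁ p) (proj₂ p)) → length Q ≤ dsq _≟_ n M s
    length≤dsq _≟_ s Q unique firstOcc =
      subst (_≤ dsq _≟_ n M s) (length-map content Q) (Unique-⊆⇒length-≤ (Unique-map⁺ content unique injective) ⊆squares)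
      where
      content = λ (p : ℕ × ℕ) → sub M s (proj₁ p) (proj₂ p)
      injective : ∀ {p q} → p ∈ Q → q ∈ Q → content p ≡ content q → p ≡ q
      injective {p} {q} p∈Q q∈Q eq with ×-≡-dec _≟ℕ_ _≟ℕ_ p q
      ... | yes p≡q = p≡q
      ... | no  p≢q = contradiction eq (FirstOcc-distinct (firstOcc p∈Q) (firstOcc q∈Q) p≢q)
      ⊆squares : ∀ {x} → x ∈ map content Q → x ∈ deduplicate (≡-dec (≡-dec _≟_)) (map content (positions n s))
      ⊆squares x∈ with ∈-map⁻ content x∈
      ... | p , p∈Q , refl = ∈-deduplicate⁺ (≡-dec (≡-dec _≟_)) (∈-map⁺ content (valid⇒∈positions (proj₁ (firstOcc p∈Q))))

    sub-entry : ∀ {s i j x y} (x<s : x < s) (y<s : y < s) →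
      lookup (lookup (sub M s i j) (fromℕ< x<s)) (fromℕ< y<s) ≡ M (i + x) (j + y)
    sub-entry {i = i} {j} x<s y<s =
      trans (cong (λ v → lookup v (fromℕ< y<s)) (lookup∘tabulate _ (fromℕ< x<s)))
        (trans (lookup∘tabulate _ (fromℕ< y<s)) (cong₂ (λ x y → M (i + x) (j + y)) (toℕ-fromℕ< x<s) (toℕ-fromℕ< y<s)))

    sub-≡⇒entry-≡ : ∀ {s i j i' j' x y} → sub M s i' j' ≡ sub M s i j → x < s → y < s →
      M (i' + x) (j' + y) ≡ M (i + x) (j + y)
    sub-≡⇒entry-≡ eq x<s y<s =
      trans (sym (sub-entry x<s y<s)) (trans (cong (λ v → lookup (lookup v (fromℕ< x<s)) (fromℕ< y<s)) eq) (sub-entry x<s y<s))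

    -- An earlier window with the same content would contain an earlier copy of the occurrence.
    FirstOcc-shift : ∀ {b w t u di dj} → FirstOcc n M b (t + di) (u + dj) → di + b ≤ w → dj + b ≤ w →
      t + w ≤ n → u + w ≤ n → FirstOcc n M w t u
    FirstOcc-shift {b} {w} {t} {u} {di} {dj} (_ , earliest) di+b≤w dj+b≤w t+w≤n u+w≤n =
      (t+w≤n , u+w≤n) , λ t' u' (t'+w≤n , u'+w≤n) t'u'<tu same →
        earliest (t' + di) (u' + dj) (fits t' t'+w≤n di+b≤w , fits u' u'+w≤n dj+b≤w) (shift-< t'u'<tu)
          (tabulate-cong λ a → tabulate-cong λ c →
            trans (cong₂ M (+-assoc t' di (toℕ a)) (+-assoc u' dj (toℕ c)))
              (trans (sub-≡⇒entry-≡ same (inner di+b≤w a) (inner dj+b≤w c))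
                (sym (cong₂ M (+-assoc t di (toℕ a)) (+-assoc u dj (toℕ c))))))
      where
      fits : ∀ x {d} → x + w ≤ n → d + b ≤ w → x + d + b ≤ n
      fits x {d} x+w≤n d+b≤w = ≤-trans (≤-reflexive (+-assoc x d b)) (≤-trans (+-monoʳ-≤ x d+b≤w) x+w≤n)
      inner : ∀ {d} → d + b ≤ w → (a : Fin b) → d + toℕ a < w
      inner {d} d+b≤w a = <-≤-trans (+-monoʳ-< d (toℕ<n a)) d+b≤w
      shift-< : ∀ {t' u'} → (t' , u') <rm (t , u) → (t' + di , u' + dj) <rm (t + di , u + dj)
      shift-< (inj₁ t'<t)         = inj₁ (+-monoˡ-< di t'<t)
      shift-< (inj₂ (refl , u'<u)) = inj₂ (refl , +-monoˡ-< dj u'<u)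

    FirstOcc-enlarge : ∀ {b w t u i j} → FirstOcc n M b i j → t ≤ i → i + b ≤ t + w → u ≤ j → j + b ≤ u + w →
      t + w ≤ n → u + w ≤ n → FirstOcc n M w t u
    FirstOcc-enlarge {b} {w} {t} {u} {i} {j} firstOcc t≤i i+b≤t+w u≤j j+b≤u+w =
      FirstOcc-shift (subst₂ (FirstOcc n M b) (sym (m+[n∸m]≡n t≤i)) (sym (m+[n∸m]≡n u≤j)) firstOcc)
        (offset-fits t≤i i+b≤t+w) (offset-fits u≤j j+b≤u+w)
      where
      offset-fits : ∀ {x y} → x ≤ y → y + b ≤ x + w → y ∸ x + b ≤ w
      offset-fits {x} {y} x≤y y+b≤x+w =
        +-cancelˡ-≤ x _ _ (subst (_≤ x + w) (trans (cong (_+ b) (sym (m+[n∸m]≡n x≤y))) (+-assoc x (y ∸ x) b)) y+b≤x+w)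

  module _ {Σ : Set} (_≟_ : DecidableEquality Σ) (n : ℕ) (M : Matrix Σ) where

    dsq≤δ2D : ∀ w .{{_ : NonZero w}} → w ≤ n → fromℕ (dsq _≟_ n M w) ℚ.≤ fromℕ (w * w) ℚ.* δ2D _≟_ n M
    dsq≤δ2D (suc t) t<n =
      subst (ℚ._≤ fromℕ (suc t * suc t) ℚ.* δ2D _≟_ n M) (fromℕ-*-/ (t + t * suc t) (dsq _≟_ n M (suc t)))
        (ℚ.*-monoˡ-≤-nonNeg (fromℕ (suc t * suc t)) {{fromℕ-nonNeg (suc t * suc t)}}
          (foldr-⊔-upper (λ t → (+ dsq _≟_ n M (suc t)) ℚ./ (suc t * suc t)) (upTo n) (∈-upTo⁺ t<n)))

    1≤δ2D : 0 < n → fromℕ 1 ℚ.≤ δ2D _≟_ n M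
    1≤δ2D 0<n = ℚ.≤-trans (fromℕ-mono-≤ 1≤dsq₁)
                  (subst (fromℕ (dsq _≟_ n M 1) ℚ.≤_) (ℚ.*-identityˡ (δ2D _≟_ n M)) (dsq≤δ2D 1 0<n))
      where
      corner : FirstOcc n M 1 0 0
      corner = (0<n , 0<n) , λ { _ _ _ (inj₁ ()) ; _ _ _ (inj₂ (_ , ())) }
      1≤dsq₁ : 1 ≤ dsq _≟_ n M 1
      1≤dsq₁ = length≤dsq n M _≟_ 1 [ (0 , 0) ] (All.[] AllPairs.∷ AllPairs.[]) λ { (here refl) → corner }

module Windows where
  open import Data.Nat
  open import Data.Nat.Properties
  open import Data.Nat.DivMod using (_%_; m<n⇒m%n≡m; [m+kn]%n≡m%n)
  open import Data.Nat.Tactic.RingSolver using (solve)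
  open import Data.Bool using (Bool; true; false)
  open import Data.List using ([]; _∷_)
  open import Function using (_∘_)
  open import Data.Product using (_×_; _,_; proj₂)
  open import Data.Empty using (⊥-elim)
  open import Relation.Nullary using (yes; no; contradiction)
  open import Relation.Binary.PropositionalEquality using (_≡_; refl; sym; trans; cong; subst)
  open ≤-Reasoning

  ≤-by : ∀ {x y} d → x + d ≡ y → x ≤ y
  ≤-by {x} d refl = m≤m+n x d

  divMod-unique : ∀ {B} .{{_ : NonZero B}} {q q' r r'} → q * B + r ≡ q' * B + r' → r < B → r' < B → q ≡ q' × r ≡ r'
  divMod-unique {B} {q} {q'} {r} {r'} eq r<B r'<B = *-cancelʳ-≡ q q' B (+-cancelʳ-≡ r (q * B) (q' * B) eq′) , r≡r'
    where
    r≡r' : r ≡ r'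
    r≡r' = begin-equality
      r                  ≡⟨ sym (m<n⇒m%n≡m r<B) ⟩
      r % B              ≡⟨ sym ([m+kn]%n≡m%n r q B) ⟩
      (r + q * B) % B    ≡⟨ cong (_% B) (trans (+-comm r (q * B)) (trans eq (+-comm (q' * B) r'))) ⟩
      (r' + q' * B) % B  ≡⟨ [m+kn]%n≡m%n r' q' B ⟩
      r' % B             ≡⟨ m<n⇒m%n≡m r'<B ⟩
      r'                 ∎
    eq′ : q * B + r ≡ q' * B + r
    eq′ = subst (λ x → q * B + r ≡ q' * B + x) (sym r≡r') eq

  Meets : (B l i : ℕ) → Set
  Meets B l i = l * B < i + B × i < l * B + B

  module Partition (κ B : ℕ) .{{_ : NonZero B}} where

    Covers : ℕ → ℕ → Set
    Covers t i = t ≤ i × i + B ≤ t + 4 * B × t + 4 * B ≤ (7 + κ) * B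

    -- The 7 + κ blocks of a line: two at each end, the interior blocks 2 + j, and, for e ≥ 2,
    -- indices high e beyond the line.
    data Row : ℕ → Set where
      first  : Row 0
      second : Row 1
      middle : ∀ j → j ≤ 2 + κ → Row (2 + j)
      high   : ∀ e → Row (5 + κ + e)

    row : ∀ l → Row l
    row 0 = first
    row 1 = second
    row (suc (suc j)) with j ≤? 2 + κ
    ... | yes j≤ = middle j j≤
    ... | no  j≰ = subst (λ x → Row (2 + x)) (proj₂ (m≤n⇒∃[o]m+o≡n (≰⇒> j≰))) (high _)

    isMiddle : ∀ {l} → Row l → Bool
    isMiddle (middle _ _) = true
    isMiddle _            = false

    widthOf : Bool → ℕ
    widthOf true  = B
    widthOf false = 1

    width : ∀ {l} → Row l → ℕ
    width r = widthOf (isMiddle r)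

    -- Only an interior block offers width B choices of window; the two blocks at the bottom
    -- need distinct windows, so they end at n - 1 and at n.
    windowAt : ∀ {l} → Row l → ℕ → ℕ
    windowAt first                _ = 0
    windowAt second               _ = 1
    windowAt (middle j _)         a = j * B + a
    windowAt (high 0)             _ = pred ((3 + κ) * B)
    windowAt (high 1)             _ = (3 + κ) * B
    windowAt (high (suc (suc _))) _ = 0

    private
      P = (3 + κ) * B
      P+4B≡n : (3 + κ) * B + 4 * B ≡ (7 + κ) * B
      P+4B≡n = solve (κ ∷ B ∷ [])
      pred<P : pred P < P
      pred<P = ≤-reflexive (suc-pred P {{m*n≢0 (3 + κ) B}})
      1<pred : 1 < pred P
      1<pred = pred-mono-≤ (≤-trans (m≤m+n 3 κ) (m≤m*n (3 + κ) B))
      0<pred : 0 < pred P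
      0<pred = m<n⇒0<n 1<pred
      1<P : 1 < P
      1<P = <-trans 1<pred pred<P
      0<P : 0 < P
      0<P = m<n⇒0<n 1<P

    meets⇒≤ : ∀ t l {i} → t + B ≤ suc (l * B) → Meets B l i → t ≤ i
    meets⇒≤ t l {i} le (lB<i+B , _) = +-cancelʳ-≤ B t i (≤-trans le lB<i+B)

    meets⇒≤+w : ∀ t l {i} → l * B + B + B ≤ suc (t + 4 * B) → Meets B l i → i + B ≤ t + 4 * B
    meets⇒≤+w t l {i} le (_ , i<lB+B) = ≤-pred (<-≤-trans (+-monoˡ-< B i<lB+B) le)

    windowAt-covers : ∀ {l i a} (r : Row l) → Meets B l i → i + B ≤ (7 + κ) * B → a < width r → Covers (windowAt r a) i
    windowAt-covers first m _ _ =
      z≤n , meets⇒≤+w 0 0 (≤-by (suc (B + B)) (solve (B ∷ []))) m , *-monoˡ-≤ B {4} {7 + κ} (s≤s (s≤s (s≤s (s≤s z≤n))))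
    windowAt-covers second m _ _ =
      meets⇒≤ 1 1 (≤-by 0 (solve (B ∷ []))) m , meets⇒≤+w 1 1 (≤-by (suc (suc B)) (solve (B ∷ []))) m , fits
      where
      fits : 1 + 4 * B ≤ (7 + κ) * B
      fits = begin
        1 + 4 * B          ≤⟨ +-monoˡ-≤ (4 * B) (>-nonZero⁻¹ B) ⟩
        B + 4 * B          ≤⟨ m≤m+n (B + 4 * B) ((2 + κ) * B) ⟩
        B + 4 * B + (2 + κ) * B ≡⟨ solve (κ ∷ B ∷ []) ⟩
        (7 + κ) * B        ∎
    windowAt-covers {i = i} {a} (middle j j≤2+κ) m _ a<B =
      meets⇒≤ (j * B + a) (2 + j) lower m , meets⇒≤+w (j * B + a) (2 + j) upper m , fits
      where
      lower : j * B + a + B ≤ suc ((2 + j) * B)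
      lower = begin
        j * B + a + B      ≤⟨ +-monoˡ-≤ B (+-monoʳ-≤ (j * B) (<⇒≤ a<B)) ⟩
        j * B + B + B      ≤⟨ n≤1+n _ ⟩
        suc (j * B + B + B) ≡⟨ solve (j ∷ B ∷ []) ⟩
        suc ((2 + j) * B)  ∎
      upper : (2 + j) * B + B + B ≤ suc (j * B + a + 4 * B)
      upper = ≤-by (suc a) (solve (j ∷ B ∷ a ∷ []))
      fits : j * B + a + 4 * B ≤ (7 + κ) * B
      fits = begin
        j * B + a + 4 * B  ≤⟨ +-monoˡ-≤ (4 * B) (+-monoʳ-≤ (j * B) (<⇒≤ a<B)) ⟩
        j * B + B + 4 * B  ≡⟨ solve (j ∷ B ∷ []) ⟩
        (5 + j) * B        ≤⟨ *-monoˡ-≤ B (+-monoʳ-≤ 5 j≤2+κ) ⟩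
        (7 + κ) * B        ∎
    windowAt-covers (high 0) m _ _ =
      meets⇒≤ (pred P) (5 + κ + 0) lower m , meets⇒≤+w (pred P) (5 + κ + 0) upper m , fits
      where
      lower : pred P + B ≤ suc ((5 + κ + 0) * B)
      lower = begin
        pred P + B         ≤⟨ +-monoˡ-≤ B (pred[n]≤n {P}) ⟩
        P + B              ≤⟨ m≤m+n (P + B) (suc (B + κ * 0)) ⟩
        (3 + κ) * B + B + suc (B + κ * 0) ≡⟨ solve (κ ∷ B ∷ []) ⟩
        suc ((5 + κ + 0) * B) ∎
      upper : (5 + κ + 0) * B + B + B ≤ suc (pred P + 4 * B)
      upper = begin
        (5 + κ + 0) * B + B + B ≡⟨ solve (κ ∷ B ∷ []) ⟩
        (7 + κ) * B             ≡⟨ sym P+4B≡n ⟩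
        P + 4 * B               ≡⟨ cong (_+ 4 * B) (sym (suc-pred P {{m*n≢0 (3 + κ) B}})) ⟩
        suc (pred P) + 4 * B    ∎
      fits : pred P + 4 * B ≤ (7 + κ) * B
      fits = ≤-trans (+-monoˡ-≤ (4 * B) (pred[n]≤n {P})) (≤-reflexive P+4B≡n)
    windowAt-covers (high 1) m i+B≤n _ =
      meets⇒≤ ((3 + κ) * B) (5 + κ + 1) (≤-by (suc (B + B)) (solve (κ ∷ B ∷ []))) m ,
      ≤-trans i+B≤n (≤-reflexive (sym P+4B≡n)) , ≤-reflexive P+4B≡n
    windowAt-covers (high (suc (suc e))) (lB<i+B , _) i+B≤n _ =
      ⊥-elim (<-irrefl refl (<-≤-trans lB<i+B (≤-trans i+B≤n (*-monoˡ-≤ B n≤l))))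
      where
      n≤l : 7 + κ ≤ 5 + κ + suc (suc e)
      n≤l = ≤-by e (solve (κ ∷ e ∷ []))

    high-≮ : ∀ e → 5 + κ + suc (suc e) ≮ 7 + κ
    high-≮ e = m+n≮m (7 + κ) e ∘ subst (_< 7 + κ) (trans (+-suc (5 + κ) (suc e)) (cong suc (+-suc (5 + κ) e)))

    windowAt-injective : ∀ {l l' a a'} (r : Row l) (r' : Row l') → l < 7 + κ → l' < 7 + κ →
      isMiddle r ≡ isMiddle r' → a < width r → a' < width r' → windowAt r a ≡ windowAt r' a' → l ≡ l' × a ≡ a'
    windowAt-injective (middle j _) (middle j' _) _ _ _ a<B a'<B eq with divMod-unique {q = j} {q' = j'} eq a<B a'<B
    ... | refl , a≡a' = refl , a≡a'
    windowAt-injective (high (suc (suc e))) _ l<K _ _ _ _ _ = contradiction l<K (high-≮ e)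
    windowAt-injective _ (high (suc (suc e))) _ l'<K _ _ _ _ = contradiction l'<K (high-≮ e)
    windowAt-injective first    first    _ _ _ (s≤s z≤n) (s≤s z≤n) _ = refl , refl
    windowAt-injective second   second   _ _ _ (s≤s z≤n) (s≤s z≤n) _ = refl , refl
    windowAt-injective (high 0) (high 0) _ _ _ (s≤s z≤n) (s≤s z≤n) _ = refl , refl
    windowAt-injective (high 1) (high 1) _ _ _ (s≤s z≤n) (s≤s z≤n) _ = refl , refl
    windowAt-injective first    second   _ _ _ _ _ ()
    windowAt-injective second   first    _ _ _ _ _ ()
    windowAt-injective first    (high 0) _ _ _ _ _ eq = contradiction eq (<⇒≢ 0<pred)
    windowAt-injective first    (high 1) _ _ _ _ _ eq = contradiction eq (<⇒≢ 0<P)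
    windowAt-injective second   (high 0) _ _ _ _ _ eq = contradiction eq (<⇒≢ 1<pred)
    windowAt-injective second   (high 1) _ _ _ _ _ eq = contradiction eq (<⇒≢ 1<P)
    windowAt-injective (high 0) first    _ _ _ _ _ eq = contradiction eq (>⇒≢ 0<pred)
    windowAt-injective (high 1) first    _ _ _ _ _ eq = contradiction eq (>⇒≢ 0<P)
    windowAt-injective (high 0) second   _ _ _ _ _ eq = contradiction eq (>⇒≢ 1<pred)
    windowAt-injective (high 1) second   _ _ _ _ _ eq = contradiction eq (>⇒≢ 1<P)
    windowAt-injective (high 0) (high 1) _ _ _ _ _ eq = contradiction eq (<⇒≢ pred<P)
    windowAt-injective (high 1) (high 0) _ _ _ _ _ eq = contradiction eq (>⇒≢ pred<P)

module Levels where
  open import Defs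
  open ListCounting
  open FirstOccurrences
  open Windows
  open Rationals using (fromℕ; module ClassBounds)
  open import Data.Rational as ℚ using (ℚ; 0ℚ)
  open import Data.Nat hiding (_≟_)
  open import Data.Nat.Properties hiding (_≟_)
  open import Data.Bool using (Bool; true; false; _≟_)
  open import Data.List using (List; []; _∷_; length; map; filter; upTo; cartesianProduct)
  open import Data.List.Properties using (length-map; length-upTo)
  open import Data.List.Membership.Propositional using (_∈_)
  open import Data.List.Membership.Propositional.Properties
    using (∈-filter⁻; ∈-map⁻; ∈-cartesianProduct⁻; ∈-cartesianProduct⁺; ∈-upTo⁺; ∈-upTo⁻)
  open import Data.List.Relation.Unary.Any using (here; there)
  open import Data.List.Relation.Unary.All as All using (All)
  open import Data.List.Relation.Unary.Unique.Propositional using (Unique)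
  open import Data.List.Relation.Unary.Unique.Propositional.Properties using (filter⁺; cartesianProduct⁺; upTo⁺)
  open import Data.Product using (_×_; _,_; proj₁; proj₂; ∃-syntax; uncurry)
  open import Relation.Nullary using (contradiction)
  open import Relation.Binary.Definitions using (DecidableEquality)
  open import Relation.Binary.PropositionalEquality using (_≡_; refl; sym; trans; cong; cong₂; subst)

  module LevelCount {Σ : Set} (_≟Σ_ : DecidableEquality Σ) (M : Matrix Σ) (κ B : ℕ) .{{_ : NonZero B}} where

    open Partition κ B

    n : ℕ
    n = (7 + κ) * B

    Touches : ℕ × ℕ → Set
    Touches (l , m) = l < 7 + κ × m < 7 + κ × ∃[ i ] ∃[ j ] FirstOcc n M B i j × Meets B l i × Meets B m j

    window : ℕ × ℕ → ℕ × ℕ → ℕ × ℕ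
    window (l , m) (a , c) = windowAt (row l) a , windowAt (row m) c

    window-FirstOcc : ∀ {l m a c} → Touches (l , m) → a < width (row l) → c < width (row m) →
      FirstOcc n M (4 * B) (windowAt (row l) a) (windowAt (row m) c)
    window-FirstOcc {l} {m} (_ , _ , _ , _ , firstOcc , meets-l , meets-m) a<w c<w
      with windowAt-covers (row l) meets-l (proj₁ (proj₁ firstOcc)) a<w
         | windowAt-covers (row m) meets-m (proj₂ (proj₁ firstOcc)) c<w
    ... | t≤i , i+B≤t+w , t+w≤n | u≤j , j+B≤u+w , u+w≤n =
      FirstOcc-enlarge n M firstOcc t≤i i+B≤t+w u≤j j+B≤u+w t+w≤n u+w≤n

    kind : ℕ → Bool
    kind l = isMiddle (row l)

    classOf : Bool → Bool → List (ℕ × ℕ) → List (ℕ × ℕ)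
    classOf x y L = filter (λ p → kind (proj₂ p) ≟ y) (filter (λ p → kind (proj₁ p) ≟ x) L)

    ∈-classOf⁻ : ∀ {x y L p} → p ∈ classOf x y L → p ∈ L × kind (proj₁ p) ≡ x × kind (proj₂ p) ≡ y
    ∈-classOf⁻ {x} {y} p∈ with ∈-filter⁻ (λ p → kind (proj₂ p) ≟ y) p∈
    ... | p∈′ , col≡y with ∈-filter⁻ (λ p → kind (proj₁ p) ≟ x) p∈′
    ... | p∈L , row≡x = p∈L , row≡x , col≡y

    Unique-classOf : ∀ {x y L} → Unique L → Unique (classOf x y L)
    Unique-classOf {x} {y} unique = filter⁺ (λ p → kind (proj₂ p) ≟ y) (filter⁺ (λ p → kind (proj₁ p) ≟ x) unique)

    length-classOf : ∀ L → length L ≡ (length (classOf true true L) + length (classOf true false L))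
                                       + (length (classOf false true L) + length (classOf false false L))
    length-classOf L = sym (trans (cong₂ _+_ (split (filter (λ p → kind (proj₁ p) ≟ true) L))
                                              (split (filter (λ p → kind (proj₁ p) ≟ false) L)))
                                  (length-filter-true+false (λ p → kind (proj₁ p)) L))
      where split = length-filter-true+false (λ p → kind (proj₂ p))

    classOf-windows-count : ∀ x y L → Unique L → All Touches L →
      length (classOf x y L) * (widthOf x * widthOf y) ≤ dsq _≟Σ_ n M (4 * B)
    classOf-windows-count x y L unique touching =
      subst (_≤ dsq _≟Σ_ n M (4 * B)) length-Q (length≤dsq n M _≟Σ_ (4 * B) Q unique-Q firstOcc-Q)
      where
      P = classOf x y L
      I = cartesianProduct (upTo (widthOf x)) (upTo (widthOf y))
      Q = map (uncurry window) (cartesianProduct P I)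
      length-Q : length Q ≡ length P * (widthOf x * widthOf y)
      length-Q = begin-equality
        length Q                            ≡⟨ length-map (uncurry window) (cartesianProduct P I) ⟩
        length (cartesianProduct P I)       ≡⟨ length-cartesianProduct P I ⟩
        length P * length I                 ≡⟨ cong (length P *_) (length-cartesianProduct (upTo (widthOf x)) (upTo (widthOf y))) ⟩
        length P * (length (upTo (widthOf x)) * length (upTo (widthOf y)))
                                            ≡⟨ cong (length P *_) (cong₂ _*_ (length-upTo (widthOf x)) (length-upTo (widthOf y))) ⟩
        length P * (widthOf x * widthOf y)  ∎
        where open ≤-Reasoning
      members : ∀ {l m a c} → ((l , m) , (a , c)) ∈ cartesianProduct P I →
        Touches (l , m) × kind l ≡ x × kind m ≡ y × a < widthOf x × c < widthOf y
      members {l} {m} lmac∈ with ∈-cartesianProduct⁻ P I lmac∈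
      ... | lm∈P , ac∈I with ∈-classOf⁻ lm∈P | ∈-cartesianProduct⁻ (upTo (widthOf x)) (upTo (widthOf y)) ac∈I
      ... | lm∈L , row≡x , col≡y | a∈ , c∈ = All.lookup touching lm∈L , row≡x , col≡y , ∈-upTo⁻ a∈ , ∈-upTo⁻ c∈
      coordinate-injective : ∀ {l l' a a' z} → l < 7 + κ → l' < 7 + κ → kind l ≡ z → kind l' ≡ z →
        a < widthOf z → a' < widthOf z → windowAt (row l) a ≡ windowAt (row l') a' → l ≡ l' × a ≡ a'
      coordinate-injective {l} {l'} l<K l'<K refl kind≡ a<w a'<w =
        windowAt-injective (row l) (row l') l<K l'<K (sym kind≡) a<w (subst (λ z → _ < widthOf z) (sym kind≡) a'<w)
      injective : ∀ {u v} → u ∈ cartesianProduct P I → v ∈ cartesianProduct P I → uncurry window u ≡ uncurry window v → u ≡ v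
      injective {(l , m) , (a , c)} {(l' , m') , (a' , c')} u∈ v∈ eq with members u∈ | members v∈
      ... | (l<K , m<K , _) , rl , cm , a<w , c<w | (l'<K , m'<K , _) , rl' , cm' , a'<w , c'<w
        with coordinate-injective l<K l'<K rl rl' a<w a'<w (cong proj₁ eq)
           | coordinate-injective m<K m'<K cm cm' c<w c'<w (cong proj₂ eq)
      ... | refl , refl | refl , refl = refl
      unique-Q : Unique Q
      unique-Q = Unique-map⁺ (uncurry window)
        (cartesianProduct⁺ (Unique-classOf unique) (cartesianProduct⁺ (upTo⁺ (widthOf x)) (upTo⁺ (widthOf y)))) injective
      firstOcc-Q : ∀ {w} → w ∈ Q → FirstOcc n M (4 * B) (proj₁ w) (proj₂ w)
      firstOcc-Q w∈ with ∈-map⁻ (uncurry window) w∈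
      ... | ((l , m) , (a , c)) , u∈ , refl with members u∈
      ... | touches , refl , refl , a<w , c<w = window-FirstOcc touches a<w c<w

    candidates : Bool → List ℕ
    candidates true  = upTo (7 + κ)
    candidates false = 0 ∷ 1 ∷ 5 + κ ∷ 6 + κ ∷ []

    ∈-candidates : ∀ {l} (r : Row l) → l < 7 + κ → l ∈ candidates (isMiddle r)
    ∈-candidates first                _   = here refl
    ∈-candidates second               _   = there (here refl)
    ∈-candidates (middle _ _)         l<K = ∈-upTo⁺ l<K
    ∈-candidates (high 0)             _   = there (there (here (+-identityʳ (5 + κ))))
    ∈-candidates (high 1)             _   = there (there (there (here (+-comm (5 + κ) 1))))
    ∈-candidates (high (suc (suc e))) l<K = contradiction l<K (high-≮ e)

    classOf-size : ∀ x y L → Unique L → All Touches L →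
      length (classOf x y L) ≤ length (candidates x) * length (candidates y)
    classOf-size x y L unique touching =
      subst (length (classOf x y L) ≤_) (length-cartesianProduct (candidates x) (candidates y))
        (Unique-⊆⇒length-≤ (Unique-classOf unique) ⊆candidates)
      where
      ⊆candidates : ∀ {p} → p ∈ classOf x y L → p ∈ cartesianProduct (candidates x) (candidates y)
      ⊆candidates {l , m} p∈ with ∈-classOf⁻ p∈
      ... | p∈L , row≡x , col≡y with All.lookup touching p∈L
      ... | l<K , m<K , _ = ∈-cartesianProduct⁺ (subst (λ z → l ∈ candidates z) row≡x (∈-candidates (row l) l<K))
                                               (subst (λ z → m ∈ candidates z) col≡y (∈-candidates (row m) m<K))

    touching-count : ∀ L → Unique L → All Touches L → ∀ {δ s} →
      fromℕ 1 ℚ.≤ δ → 0ℚ ℚ.≤ s → fromℕ n ℚ.* δ ℚ.≤ s ℚ.* s →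
      fromℕ (dsq _≟Σ_ n M (4 * B)) ℚ.≤ fromℕ ((4 * B) * (4 * B)) ℚ.* δ →
      fromℕ (length L) ℚ.≤ fromℕ 64 ℚ.* (δ ℚ.+ s)
    touching-count L unique touching 1≤δ 0≤s nδ≤ss d≤ =
      subst (λ z → fromℕ z ℚ.≤ _) (sym (length-classOf L))
        (classes-bound (count true true) (count true false) (count false true) (count false false)
          (windows true true)
          (subst (λ z → count true false * z ≤ d) (*-identityʳ B) (windows true false))
          (subst (count true false ≤_) (trans (cong (_* 4) (length-upTo (7 + κ))) (*-comm (7 + κ) 4)) (size true false))
          (subst (λ z → count false true * z ≤ d) (*-identityˡ B) (windows false true))
          (subst (λ z → count false true ≤ 4 * z) (length-upTo (7 + κ)) (size false true))
          (size false false))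
      where
      d = dsq _≟Σ_ n M (4 * B)
      open ClassBounds B (7 + κ) d 1≤δ 0≤s d≤ nδ≤ss
      count : Bool → Bool → ℕ
      count x y = length (classOf x y L)
      windows = λ x y → classOf-windows-count x y L unique touching
      size = λ x y → classOf-size x y L unique touching

module BlockTree where
  open import Defs
  open ListCounting
  open Rationals
  open FirstOccurrences
  open Windows using (Meets)
  open Levels
  open import Data.Nat as ℕ using (ℕ; zero; suc; _^_; _∸_; _<_; _≤_; s≤s; z≤n; NonZero; _≤?_)
  import Data.Nat.Properties as ℕ
  open import Data.List using (List; length; upTo)
  open import Data.List.Properties using (length-upTo)
  open import Data.List.Membership.Propositional.Properties using (∈-upTo⁺; ∈-cartesianProduct⁺)
  open import Data.List.Relation.Unary.All as All using (All)
  open import Data.List.Relation.Unary.Unique.Propositional using (Unique)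
  open import Data.Product using (_×_; _,_; proj₁; proj₂; ∃-syntax; uncurry)
  open import Data.Rational as ℚ using (ℚ; 0ℚ)
  import Data.Rational.Properties as ℚ
  open import Relation.Nullary using (Dec; yes; no)
  open import Relation.Binary.Definitions using (DecidableEquality)
  open import Relation.Binary.PropositionalEquality using (_≡_; refl; sym; trans; cong; cong₂; subst)

  InSquare-overlap⇒Meets : ∀ {b l m i j x y} → InSquare b (l ℕ.* b) (m ℕ.* b) x y → InSquare b i j x y →
    Meets b l i × Meets b m j
  InSquare-overlap⇒Meets (lb≤x , x<lb+b , mb≤y , y<mb+b) (i≤x , x<i+b , j≤y , y<j+b) =
    (ℕ.≤-<-trans lb≤x x<i+b , ℕ.≤-<-trans i≤x x<lb+b) , (ℕ.≤-<-trans mb≤y y<j+b , ℕ.≤-<-trans j≤y y<mb+b)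

  module _ {Σ : Set} (k α : ℕ) (M : Matrix Σ) where

    Marked⇒< : ∀ ℓ {l m} → Marked k α M ℓ l m → l < k ^ ℓ × m < k ^ ℓ
    Marked⇒< zero    (refl , refl) = s≤s z≤n , s≤s z≤n
    Marked⇒< (suc ℓ) ((p , q , parent , _ , l<pk+k , _ , m<qk+k) , _) with Marked⇒< ℓ parent
    ... | p<kᶫ , q<kᶫ = child-< p<kᶫ l<pk+k , child-< q<kᶫ m<qk+k
      where
      child-< : ∀ {p x} → p < k ^ ℓ → x < p ℕ.* k ℕ.+ k → x < k ^ suc ℓ
      child-< {p} p<kᶫ x<pk+k = ℕ.<-≤-trans x<pk+k (ℕ.≤-trans (ℕ.≤-reflexive (ℕ.+-comm (p ℕ.* k) k))
                                 (ℕ.≤-trans (ℕ.*-monoˡ-≤ k p<kᶫ) (ℕ.≤-reflexive (ℕ.*-comm (k ^ ℓ) k))))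

    Marked⇒overlap : ∀ ℓ {l m} → Marked k α M (suc ℓ) l m →
      let b = k ^ (α ∸ suc ℓ) in ∃[ i ] ∃[ j ] FirstOcc (k ^ α) M b i j × Meets b l i × Meets b m j
    Marked⇒overlap ℓ {l} {m} (_ , i , j , firstOcc , _ , _ , inBlock , inOcc) =
      i , j , firstOcc , InSquare-overlap⇒Meets {l = l} {m} inBlock inOcc

  module _ {Σ : Set} (_≟_ : DecidableEquality Σ) (k α : ℕ) .{{_ : NonZero k}} (M : Matrix Σ) where

    length≤blocks² : ∀ ℓ L → Unique L → All (uncurry (Marked k α M ℓ)) L → length L ≤ k ^ ℓ ℕ.* k ^ ℓ
    length≤blocks² ℓ L unique marked =
      subst (length L ≤_) (trans (length-cartesianProduct blocks blocks) (cong₂ ℕ._*_ (length-upTo (k ^ ℓ)) (length-upTo (k ^ ℓ))))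
        (Unique-⊆⇒length-≤ unique λ lm∈L →
          let l< , m< = Marked⇒< k α M ℓ (All.lookup marked lm∈L) in ∈-cartesianProduct⁺ (∈-upTo⁺ l<) (∈-upTo⁺ m<))
      where blocks = upTo (k ^ ℓ)

    many-blocks : ∀ ℓ → 7 ≤ k ^ ℓ → ℓ ≤ α → ∀ {s} → 0ℚ ℚ.≤ s →
      fromℕ (k ^ α) ℚ.* δ2D _≟_ (k ^ α) M ℚ.≤ s ℚ.* s →
      ∀ L → Unique L → All (uncurry (Marked k α M ℓ)) L → fromℕ (length L) ℚ.≤ fromℕ 64 ℚ.* (δ2D _≟_ (k ^ α) M ℚ.+ s)
    many-blocks zero (s≤s ())
    many-blocks (suc ℓ) 7≤k^ℓ ℓ≤α {s} 0≤s nδ≤ss L unique marked =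
      subst (λ n → fromℕ (length L) ℚ.≤ fromℕ 64 ℚ.* (δ2D _≟_ n M ℚ.+ s)) (sym n≡KB)
        (touching-count L unique (All.map touches marked) (1≤δ2D _≟_ ((7 ℕ.+ κ) ℕ.* B) M 0<n) 0≤s
          (subst (λ n → fromℕ n ℚ.* δ2D _≟_ n M ℚ.≤ s ℚ.* s) n≡KB nδ≤ss)
          (dsq≤δ2D _≟_ ((7 ℕ.+ κ) ℕ.* B) M (4 ℕ.* B) {{ℕ.m*n≢0 4 B}} (ℕ.*-monoˡ-≤ B {4} {7 ℕ.+ κ} 4≤7+κ)))
      where
      κ = proj₁ (ℕ.m≤n⇒∃[o]m+o≡n 7≤k^ℓ)
      k^ℓ≡K : k ^ suc ℓ ≡ 7 ℕ.+ κ
      k^ℓ≡K = sym (proj₂ (ℕ.m≤n⇒∃[o]m+o≡n 7≤k^ℓ))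
      B = k ^ (α ∸ suc ℓ)
      instance
        B≢0 : NonZero B
        B≢0 = ℕ.m^n≢0 k (α ∸ suc ℓ)
      open LevelCount _≟_ M κ B
      0<n : 0 < (7 ℕ.+ κ) ℕ.* B
      0<n = ℕ.>-nonZero⁻¹ ((7 ℕ.+ κ) ℕ.* B) {{ℕ.m*n≢0 (7 ℕ.+ κ) B}}
      n≡KB : k ^ α ≡ (7 ℕ.+ κ) ℕ.* B
      n≡KB = trans (cong (k ^_) (sym (ℕ.m+[n∸m]≡n ℓ≤α)))
               (trans (ℕ.^-distribˡ-+-* k (suc ℓ) (α ∸ suc ℓ)) (cong (ℕ._* B) k^ℓ≡K))
      4≤7+κ : 4 ≤ 7 ℕ.+ κ
      4≤7+κ = s≤s (s≤s (s≤s (s≤s z≤n)))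
      touches : ∀ {p} → uncurry (Marked k α M (suc ℓ)) p → Touches p
      touches {l , m} marked-lm =
        let l< , m< = Marked⇒< k α M (suc ℓ) marked-lm
            i , j , firstOcc , meets-l , meets-m = Marked⇒overlap k α M ℓ marked-lm
        in subst (l <_) k^ℓ≡K l< , subst (m <_) k^ℓ≡K m< , i , j , subst (λ n → FirstOcc n M B i j) n≡KB firstOcc , meets-l , meets-m

    few-blocks : ∀ ℓ {s} → 0ℚ ℚ.≤ s → k ^ ℓ ≤ 6 →
      ∀ L → Unique L → All (uncurry (Marked k α M ℓ)) L → fromℕ (length L) ℚ.≤ fromℕ 64 ℚ.* (δ2D _≟_ (k ^ α) M ℚ.+ s)
    few-blocks ℓ 0≤s k^ℓ≤6 L unique marked =
      fromℕ-≤-scaled 64 (ℚ.≤-trans (1≤δ2D _≟_ (k ^ α) M (ℕ.m^n>0 k α)) (p≤p+q 0≤s))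
        (ℕ.≤-trans (length≤blocks² ℓ L unique marked) (ℕ.≤-trans (ℕ.*-mono-≤ k^ℓ≤6 k^ℓ≤6) (ℕ.m≤m+n 36 28)))

  marked-count : ∀ {Σ : Set} (_≟_ : DecidableEquality Σ) (k α : ℕ) → 2 ≤ k → 1 ≤ α →
    (M : Matrix Σ) → (ℓ : ℕ) → ℓ ≤ α →
    (s : ℚ) → 0ℚ ℚ.≤ s → fromℕ (k ^ α) ℚ.* δ2D _≟_ (k ^ α) M ℚ.≤ s ℚ.* s →
    (L : List (ℕ × ℕ)) → Unique L → All (uncurry (Marked k α M ℓ)) L →
    fromℕ (length L) ℚ.≤ fromℕ 64 ℚ.* (δ2D _≟_ (k ^ α) M ℚ.+ s)
  marked-count _≟_ k@(suc (suc _)) α (s≤s (s≤s z≤n)) _ M ℓ ℓ≤α s 0≤s nδ≤ss L unique marked = by-size (7 ≤? k ^ ℓ)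
    where
    by-size : Dec (7 ≤ k ^ ℓ) → fromℕ (length L) ℚ.≤ fromℕ 64 ℚ.* (δ2D _≟_ (k ^ α) M ℚ.+ s)
    by-size (no  k^ℓ≱7) = few-blocks _≟_ k α M ℓ 0≤s (ℕ.≤-pred (ℕ.≰⇒> k^ℓ≱7)) L unique marked
    by-size (yes 7≤k^ℓ) = many-blocks _≟_ k α M ℓ 7≤k^ℓ ℓ≤α 0≤s nδ≤ss L unique marked

open import Defs
open import Data.Nat using (ℕ; _^_; _≤_)
open import Data.List using (List; length)
open import Data.List.Relation.Unary.All using (All)
open import Data.List.Relation.Unary.Unique.Propositional using (Unique)
open import Data.Product using (_×_; ∃-syntax; uncurry)
open import Data.Integer using (+_)
open import Data.Rational using (ℚ; _*_; _+_; _/_; 0ℚ) renaming (_≤_ to _≤ℚ_)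
open import Relation.Binary.Definitions using (DecidableEquality)
open import Data.Product using (_,_)

lemma6 : ∃[ C ] ∀ {Σ : Set} (_≟_ : DecidableEquality Σ) (k α : ℕ) → 2 ≤ k → 1 ≤ α →
    (M : Matrix Σ) → (ℓ : ℕ) → ℓ ≤ α →
    (s : ℚ) → 0ℚ ≤ℚ s → ((+ (k ^ α)) / 1) * δ2D _≟_ (k ^ α) M ≤ℚ s * s →
    (L : List (ℕ × ℕ)) → Unique L → All (uncurry (Marked k α M ℓ)) L →
    ((+ length L) / 1) ≤ℚ ((+ C) / 1) * (δ2D _≟_ (k ^ α) M + s)
lemma6 = 64 , BlockTree.marked-count
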